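{- For every finite simple graph $G$ (with at least one vertex), $\Sigma(G) < \chi_f(G)\,|V(G)|$.
   Context: All graphs are finite, undirected, without loops or multiple edges. A proper coloring of a graph $G$ is a map $c: V(G)\to \{1,2,3,\dots\}$ with adjacent vertices receiving different colors; $\Sigma_c(G)=\sum_{v\in V(G)} c(v)$, and the chromatic sum is $\Sigma(G)=\min_c \Sigma_c(G)$ over proper colorings $c$. For positive integers $m\ge 2n$, the Kneser graph $KG(m,n)$ has as vertices the $n$-element subsets of $\{1,\dots,m\}$, two being adjacent iff they are disjoint. The fractional chromatic number $\chi_f(G)$ is the minimum of $m/n$ over all pairs $(m,n)$ with $m \ge 2n$ such that there is a graph homomorphism from $G$ to $KG(m,n)$ (a homomorphism being a vertex map sending edges to edges). -}

module Defs where

open import Data.Nat using (ℕ; zero; suc; _+_; _*_; _≤_; _<_)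
open import Data.Fin using (Fin)
open import Data.List using (map; allFin)
open import Data.Nat.ListAction using (sum)
open import Data.Fin.Subset using (Subset; ∣_∣; _∩_; Empty)
open import Data.Product using (Σ; _×_; _,_; proj₁)
open import Relation.Nullary using (¬_)
open import Relation.Binary.PropositionalEquality using (_≡_; _≢_)

record Graph (N : ℕ) : Set₁ where
  field
    Adj   : Fin N → Fin N → Set
    sym   : ∀ {u v} → Adj u v → Adj v u
    irrefl : ∀ {v} → ¬ Adj v v
open Graph public

record ProperColoring {N : ℕ} (G : Graph N) : Set where
  field
    color    : Fin N → ℕ
    positive : ∀ v → 1 ≤ color v
    proper   : ∀ {u v} → Adj G u v → color u ≢ color v
open ProperColoring public

colorSum : ∀ {N} {G : Graph N} → ProperColoring G → ℕ
colorSum {N} c = sum (map (color c) (allFin N))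

IsChromaticSum : ∀ {N} → Graph N → ℕ → Set
IsChromaticSum G s =
  Σ (ProperColoring G) (λ c → colorSum c ≡ s)
  × (∀ (c : ProperColoring G) → s ≤ colorSum c)

KneserVertex : ℕ → ℕ → Set
KneserVertex m n = Σ (Subset m) (λ S → ∣ S ∣ ≡ n)

KneserAdj : ∀ {m n} → KneserVertex m n → KneserVertex m n → Set
KneserAdj (S , _) (T , _) = Empty (S ∩ T)

record KneserHom {N : ℕ} (G : Graph N) (m n : ℕ) : Set where
  field
    map-v : Fin N → KneserVertex m n
    preserves : ∀ {u v} → Adj G u v → KneserAdj (map-v u) (map-v v)

Admissible : ∀ {N} → Graph N → ℕ → ℕ → Set
Admissible G m n = (1 ≤ n) × (2 * n ≤ m) × KneserHom G m n

-- m/n is the fractional chromatic number χ_f(G): (m,n) admissible and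
-- m/n ≤ m'/n' (i.e. m * n' ≤ m' * n) for every admissible (m',n').
IsFractionalChromaticNumber : ∀ {N} → Graph N → ℕ → ℕ → Set
IsFractionalChromaticNumber G m n =
  Admissible G m n
  × (∀ m' n' → Admissible G m' n' → m * n' ≤ m' * n)

-- Let G → KG(m,n) send each vertex v to an n-set S(v) ⊆ {1,…,m}.  Greedily
-- list the points of {1,…,m}, each time taking a point lying in as many
-- remaining sets as possible, and give v the position of the first listed point
-- of S(v); adjacent vertices have disjoint sets, so this colouring is proper.
-- The sets of the still uncoloured vertices each contain n of the k unlisted
-- points, so the next point lies in at least an n/k fraction of them; induction
-- on k then bounds the colour sum by |V|(m+1)/(n+1).  Hence
-- Σ(G)·n ≤ |V|(m+1)n/(n+1) < |V|·m because n < m.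
module Submission where

open import Defs
open import Data.Nat using (ℕ; zero; suc; _+_; _*_; _≤_; _<_; z≤n; s≤s; >-nonZero)
open import Data.Nat.Properties
open import Data.Nat.ListAction using (sum)
open import Data.Nat.ListAction.Properties using (sum-↭)
open import Data.Nat.Tactic.RingSolver using (solve-∀)
open import Algebra.Properties.CommutativeSemigroup +-commutativeSemigroup
  using (interchange; x∙yz≈y∙xz)
open import Data.Bool using (if_then_else_)
open import Data.Fin.Subset using (Subset; ∣_∣; inside; outside)
open import Data.Fin.Subset.Properties using (_∈?_; x∈p∩q⁺)
open import Data.Vec using ([]; _∷_)
open import Data.List using (List; []; _∷_; _++_; map; filter; length; allFin; tabulate)
open import Data.List.Properties using (map-tabulate; length-tabulate)
open import Data.List.Relation.Unary.All as All using (All; []; _∷_)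
open import Data.List.Relation.Unary.Any using (Any; here; there)
open import Data.List.Membership.Propositional using (_∈_)
open import Data.List.Membership.Propositional.Properties
  using (∈-allFin; ∈-filter⁺; ∈-filter⁻; ∈-∃++)
open import Data.List.Relation.Binary.Permutation.Propositional using (_↭_)
open import Data.List.Relation.Binary.Permutation.Propositional.Properties
  using (map⁺; ↭-length; shift)
open import Data.List.Extrema.Nat using (argmax; argmax-sel; f[⊥]≤f[argmax]; f[xs]≤f[argmax])
open import Data.Product using (∃; ∃₂; _×_; _,_; proj₁; proj₂)
open import Data.Sum using ([_,_]′)
open import Function using (_∘_; id)
open import Relation.Nullary using (¬_; Dec; yes; no; ¬?; does; contradiction)
open import Relation.Nullary.Decidable using (dec-false)
open import Relation.Binary.PropositionalEquality as ≡
  using (_≡_; refl; trans; cong; subst; module ≡-Reasoning)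

module _ {A : Set} where

  sum-map-+ : (f g : A → ℕ) (xs : List A) →
              sum (map (λ x → f x + g x) xs) ≡ sum (map f xs) + sum (map g xs)
  sum-map-+ f g []       = refl
  sum-map-+ f g (x ∷ xs) = trans (cong (f x + g x +_) (sum-map-+ f g xs))
                                 (interchange (f x) (g x) _ _)

  sum-map-zero : (xs : List A) → sum (map (λ _ → 0) xs) ≡ 0
  sum-map-zero []       = refl
  sum-map-zero (_ ∷ xs) = sum-map-zero xs

  sum-map≤length* : ∀ {f : A → ℕ} {k xs} → All (λ x → f x ≤ k) xs →
                    sum (map f xs) ≤ length xs * k
  sum-map≤length* []         = z≤n
  sum-map≤length* (fx≤k ∷ p) = +-mono-≤ fx≤k (sum-map≤length* p)

  length*≤sum-map : ∀ {f : A → ℕ} {k xs} → All (λ x → k ≤ f x) xs →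
                    length xs * k ≤ sum (map f xs)
  length*≤sum-map []         = z≤n
  length*≤sum-map (k≤fx ∷ p) = +-mono-≤ k≤fx (length*≤sum-map p)

  argmax-∈ : (f : A → ℕ) (x : A) (xs : List A) → argmax f x xs ∈ x ∷ xs
  argmax-∈ f x xs = [ here , there ]′ (argmax-sel f x xs)

  maximum-↭ : (f : A → ℕ) (x : A) (xs : List A) →
              ∃₂ λ r rest → x ∷ xs ↭ r ∷ rest × All (λ y → f y ≤ f r) (x ∷ xs)
  maximum-↭ f x xs with ys , zs , split ← ∈-∃++ (argmax-∈ f x xs) =
    r , ys ++ zs , subst (_↭ r ∷ ys ++ zs) (≡.sym split) (shift r ys zs) ,
    f[⊥]≤f[argmax] {f = f} x xs ∷ f[xs]≤f[argmax] {f = f} x xs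
    where r = argmax f x xs

double-counting : ∀ {A B : Set} (f : A → B → ℕ) (as : List A) (bs : List B) →
  sum (map (λ a → sum (map (f a) bs)) as) ≡ sum (map (λ b → sum (map (λ a → f a b) as)) bs)
double-counting f []       bs = ≡.sym (sum-map-zero bs)
double-counting f (a ∷ as) bs = trans (cong (sum (map (f a) bs) +_) (double-counting f as bs))
                                      (≡.sym (sum-map-+ (f a) _ bs))

-- Of X vertices, A take the first colour and the other Y, with colour sum S
-- in the remaining ordering, are shifted up by one.
greedy-step : ∀ {X Y A S n K} → A + Y ≡ X → S * suc n ≤ Y * suc K → X * n ≤ suc K * A →
              (X + S) * suc n ≤ X * suc (suc K)
greedy-step {Y = Y} {A} {S} {n} {K} refl S-bound X-bound = begin
  (A + Y + S) * suc n                ≡⟨ expand A Y S n ⟩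
  A + Y + (A + Y) * n + S * suc n    ≤⟨ +-mono-≤ (+-monoʳ-≤ (A + Y) X-bound) S-bound ⟩
  A + Y + suc K * A + Y * suc K      ≡⟨ collect A Y K ⟩
  (A + Y) * suc (suc K)              ∎
  where
  open ≤-Reasoning
  expand : ∀ A Y S n → (A + Y + S) * suc n ≡ A + Y + (A + Y) * n + S * suc n
  expand = solve-∀
  collect : ∀ A Y K → A + Y + suc K * A + Y * suc K ≡ (A + Y) * suc (suc K)
  collect = solve-∀

-- R r v says that colour r is available to vertex v; an ordering ord of the
-- colours gives v the colour 1 + (index in ord of its first available colour).
module Greedy {C V : Set} {R : C → V → Set} (R? : ∀ r v → Dec (R r v)) where

  hit : C → V → ℕ
  hit r v = if does (R? r v) then 1 else 0

  degree : List V → C → ℕ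
  degree xs r = sum (map (hit r) xs)

  hits : List C → V → ℕ
  hits rs v = sum (map (λ r → hit r v) rs)

  avoiders : C → List V → List V
  avoiders r = filter (λ v → ¬? (R? r v))

  Covers : List C → V → Set
  Covers ord v = Any (λ r → R r v) ord

  -- An uncovered vertex gets index length ord.
  firstHit : List C → V → ℕ
  firstHit []        v = 0
  firstHit (r ∷ ord) v = if does (R? r v) then 0 else suc (firstHit ord v)

  greedyColor : List C → V → ℕ
  greedyColor ord v = suc (firstHit ord v)

  greedySum : List C → List V → ℕ
  greedySum ord xs = sum (map (greedyColor ord) xs)

  firstHit-common : ∀ ord {u v} → Covers ord u → firstHit ord u ≡ firstHit ord v →
                    ∃ λ r → R r u × R r v
  firstHit-common (r ∷ ord) {u} {v} cov eq with R? r u | R? r v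
  ... | yes ru | yes rv = r , ru , rv
  firstHit-common (r ∷ ord) cov          ()  | yes _   | no _
  firstHit-common (r ∷ ord) cov          ()  | no _    | yes _
  firstHit-common (r ∷ ord) (here ru)    _   | no ¬ru  | no _ = contradiction ru ¬ru
  firstHit-common (r ∷ ord) (there cov)  eq  | no _    | no _ =
    firstHit-common ord cov (suc-injective eq)

  degree+avoiders : ∀ r xs → degree xs r + length (avoiders r xs) ≡ length xs
  degree+avoiders r []       = refl
  degree+avoiders r (v ∷ xs) with R? r v
  ... | yes _ = cong suc (degree+avoiders r xs)
  ... | no _  = trans (+-suc (degree xs r) _) (cong suc (degree+avoiders r xs))

  greedySum-∷ : ∀ r ord xs →
                greedySum (r ∷ ord) xs ≡ length xs + greedySum ord (avoiders r xs)
  greedySum-∷ r ord []       = refl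
  greedySum-∷ r ord (v ∷ xs) with R? r v
  ... | yes _ = cong suc (greedySum-∷ r ord xs)
  ... | no _  = cong suc (trans (cong (greedyColor ord v +_) (greedySum-∷ r ord xs))
                                (x∙yz≈y∙xz (greedyColor ord v) (length xs) _))

  hits-↭ : ∀ {rs r rest v} → rs ↭ r ∷ rest → ¬ R r v → hits rs v ≡ hits rest v
  hits-↭ {r = r} {rest} {v} σ ¬rv =
    trans (sum-↭ (map⁺ (λ r → hit r v) σ))
          (cong (λ b → (if b then 1 else 0) + hits rest v) (dec-false (R? r v) ¬rv))

  covers-∷ : ∀ r ord xs → All (Covers ord) (avoiders r xs) → All (Covers (r ∷ ord)) xs
  covers-∷ r ord xs cov = All.tabulate covers
    where
    covers : ∀ {v} → v ∈ xs → Covers (r ∷ ord) v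
    covers {v} v∈xs with R? r v
    ... | yes rv  = here rv
    ... | no ¬rv  = there (All.lookup cov (∈-filter⁺ (λ v → ¬? (R? r v)) v∈xs ¬rv))

  hits-avoiders : ∀ {n rs r rest} xs → rs ↭ r ∷ rest → All (λ v → n ≤ hits rs v) xs →
                  All (λ v → n ≤ hits rest v) (avoiders r xs)
  hits-avoiders {n} {r = r} xs σ inv = All.tabulate λ v∈ →
    let v∈xs , ¬rv = ∈-filter⁻ (λ v → ¬? (R? r v)) v∈
    in subst (n ≤_) (hits-↭ σ ¬rv) (All.lookup inv v∈xs)

  max-degree-bound : ∀ {n} rs xs {r} → All (λ v → n ≤ hits rs v) xs →
                     All (λ c → degree xs c ≤ degree xs r) rs →
                     length xs * n ≤ length rs * degree xs r
  max-degree-bound {n} rs xs {r} inv maximal = begin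
    length xs * n                  ≤⟨ length*≤sum-map inv ⟩
    sum (map (hits rs) xs)         ≡⟨ double-counting hit rs xs ⟨
    sum (map (degree xs) rs)       ≤⟨ sum-map≤length* maximal ⟩
    length rs * degree xs r        ∎
    where open ≤-Reasoning

  greedy : ∀ {n} → 1 ≤ n → ∀ K rs → length rs ≡ K → ∀ xs → All (λ v → n ≤ hits rs v) xs →
           ∃ λ ord → All (Covers ord) xs × greedySum ord xs * suc n ≤ length xs * suc K
  greedy _ _ _ _ [] _ = [] , [] , z≤n
  greedy 1≤n zero    []        _   (_ ∷ _) (n≤0 ∷ _) = contradiction (≤-trans 1≤n n≤0) λ ()
  greedy _   zero    (_ ∷ _)   ()  _       _
  greedy _   (suc K) []        ()  _       _
  greedy {n} 1≤n (suc K) (x ∷ rs) len xs inv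
    with r , rest , σ , maximal ← maximum-↭ (degree xs) x rs
    with ord , cov , bound ← greedy 1≤n K rest (suc-injective (trans (≡.sym (↭-length σ)) len))
                                    (avoiders r xs) (hits-avoiders xs σ inv) =
    r ∷ ord , covers-∷ r ord xs cov , (begin
      greedySum (r ∷ ord) xs * suc n
        ≡⟨ cong (_* suc n) (greedySum-∷ r ord xs) ⟩
      (length xs + greedySum ord (avoiders r xs)) * suc n
        ≤⟨ greedy-step (degree+avoiders r xs) bound degree-bound ⟩
      length xs * suc (suc K) ∎)
    where
    open ≤-Reasoning
    degree-bound : length xs * n ≤ suc K * degree xs r
    degree-bound = subst (λ k → length xs * n ≤ k * degree xs r) len
                         (max-degree-bound (x ∷ rs) xs inv maximal)

sum-indicator : ∀ {m} (S : Subset m) →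
                sum (tabulate (λ r → if does (r ∈? S) then 1 else 0)) ≡ ∣ S ∣
sum-indicator []            = refl
sum-indicator (inside ∷ S)  = cong suc (sum-indicator S)
sum-indicator (outside ∷ S) = sum-indicator S

module _ {N m n} {G : Graph N} (hom : KneserHom G m n) where
  open KneserHom hom
  open Greedy (λ r v → r ∈? proj₁ (map-v v))

  hits-allFin : ∀ v → hits (allFin m) v ≡ n
  hits-allFin v = begin
    hits (allFin m) v                ≡⟨ cong sum (map-tabulate id (λ r → hit r v)) ⟩
    sum (tabulate (λ r → hit r v))   ≡⟨ sum-indicator (proj₁ (map-v v)) ⟩
    ∣ proj₁ (map-v v) ∣              ≡⟨ proj₂ (map-v v) ⟩
    n                                ∎
    where open ≡-Reasoning

  greedyProperColoring : ∀ ord → All (Covers ord) (allFin N) → ProperColoring G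
  greedyProperColoring ord cov = record
    { color    = greedyColor ord
    ; positive = λ _ → s≤s z≤n
    ; proper   = λ {u} {v} u~v same →
        let r , r∈u , r∈v = firstHit-common ord (All.lookup cov (∈-allFin u)) (suc-injective same)
        in preserves u~v (r , x∈p∩q⁺ (r∈u , r∈v))
    }

  kneserHom⇒greedyColoring : 1 ≤ n → ∃ λ (c : ProperColoring G) → colorSum c * suc n ≤ N * suc m
  kneserHom⇒greedyColoring 1≤n
    with ord , cov , bound ← greedy 1≤n m (allFin m) (length-tabulate {n = m} id) (allFin N)
                                    (All.tabulate λ {v} _ → ≤-reflexive (≡.sym (hits-allFin v))) =
    greedyProperColoring ord cov ,
    subst (λ k → greedySum ord (allFin N) * suc n ≤ k * suc m) (length-tabulate {n = N} id) bound

s[1+n]≤N[1+m]⇒sn<mN : ∀ {s n m N} → s * suc n ≤ N * suc m → n < m → 1 ≤ N → s * n < m * N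
s[1+n]≤N[1+m]⇒sn<mN {s} {n} {m} {N} bound n<m 1≤N = *-cancelʳ-< (suc n) (s * n) (m * N) (begin-strict
  s * n * suc n          ≡⟨ swap s n ⟩
  s * suc n * n          ≤⟨ *-monoˡ-≤ n bound ⟩
  N * suc m * n          ≡⟨ expand N m n ⟩
  N * n + N * (m * n)    <⟨ +-monoˡ-< (N * (m * n)) (*-monoʳ-< N {{>-nonZero 1≤N}} n<m) ⟩
  N * m + N * (m * n)    ≡⟨ collect N m n ⟩
  m * N * suc n          ∎)
  where
  open ≤-Reasoning
  swap : ∀ s n → s * n * suc n ≡ s * suc n * n
  swap = solve-∀
  expand : ∀ N m n → N * suc m * n ≡ N * n + N * (m * n)
  expand = solve-∀
  collect : ∀ N m n → N * m + N * (m * n) ≡ m * N * suc n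
  collect = solve-∀

-- Only the admissibility of (m, n) is used: the bound holds for every such pair.
mainTheorem2 : ∀ (N : ℕ) → 1 ≤ N → (G : Graph N) →
    ∀ (s m n : ℕ) → IsChromaticSum G s → IsFractionalChromaticNumber G m n →
    s * n < m * N
mainTheorem2 N 1≤N G s m n (_ , s-minimal) ((1≤n , 2n≤m , hom) , _)
  with c , c-bound ← kneserHom⇒greedyColoring hom 1≤n =
  s[1+n]≤N[1+m]⇒sn<mN {s} (≤-trans (*-monoˡ-≤ (suc n) (s-minimal c)) c-bound) n<m 1≤N
  where
  n<m : n < m
  n<m = <-≤-trans (m<m+n n 1≤n) (subst (_≤ m) (cong (n +_) (+-identityʳ n)) 2n≤m)
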